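{- Let $C=(V',E')$ be a finite connected undirected simple graph, and let $P$ be the set of BFS-trees of $C$, one rooted at each vertex $v\in V'$. Let $T_m\in P$, with root $r$, be a tree in $P$ with minimal $S_d$ among all trees in $P$. Then $r$ is a centroid of $T_m$.
   Context: A BFS-tree of a connected graph with root $v$ is a spanning tree constructed by breadth-first search starting at $v$, visiting vertices level by level (by distance from $v$), each vertex being attached via the edge through which it is first discovered. For a rooted tree $T$ with root $r$ and vertex set $V'$, $S_d(T)=\sum_{x\in V'} d_T(r,x)$, where $d_T(x,y)$ is the length of the unique path between $x$ and $y$ in $T$. The vertex deviation of $v$ in $T$ is $m(v)=\frac{1}{|V'|}\sum_{u\in V'} d_T(v,u)$; a centroid of $T$ is a vertex minimizing $m(v)$. -}

module Defs where

open import Data.Nat using (ℕ; zero; suc; _≤_)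
open import Data.Fin using (Fin)
open import Data.List using (List; []; _∷_; _++_; length; tabulate)
open import Data.Nat.ListAction using (sum)
open import Data.List.Membership.Propositional using (_∈_; _∉_)
open import Data.List.Relation.Unary.Unique.Propositional using (Unique)
open import Data.Maybe using (Maybe; just; nothing)
open import Data.Product using (Σ; _×_; ∃; ∃-syntax)
open import Data.Sum using (_⊎_)
open import Data.Integer using (+_)
open import Data.Rational.Unnormalised using (ℚᵘ; _/_) renaming (_≤_ to _≤ℚ_)
open import Relation.Binary.PropositionalEquality using (_≡_)
open import Relation.Nullary using (¬_)
open import Function.Bundles using (_⇔_)

record Graph (n : ℕ) : Set₁ where
  field
    Adj   : Fin n → Fin n → Set
    sym   : ∀ {x y} → Adj x y → Adj y x
    irref : ∀ {x} → ¬ Adj x x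
open Graph public

data Walk {n : ℕ} (E : Fin n → Fin n → Set) : Fin n → Fin n → List (Fin n) → Set where
  here  : ∀ {x} → Walk E x x (x ∷ [])
  there : ∀ {x z y vs} → E x z → Walk E z y vs → Walk E x y (x ∷ vs)

Connected : ∀ {n} → Graph n → Set
Connected G = ∀ x y → ∃[ vs ] Walk (Adj G) x y vs

-- A rooted tree is given by its parent map (root and only root has no parent).
ParentMap : ℕ → Set
ParentMap n = Fin n → Maybe (Fin n)

TEdge : ∀ {n} → ParentMap n → Fin n → Fin n → Set
TEdge par x y = (par x ≡ just y) ⊎ (par y ≡ just x)

-- d_T(x,y) ≡ k : there is a path (walk without repeated vertices) in T from x to y
-- with k edges (in a tree this path is unique).
TreeDist : ∀ {n} → ParentMap n → Fin n → Fin n → ℕ → Set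
TreeDist T x y k = Σ (List _) λ vs → Walk (TEdge T) x y vs × Unique vs × length vs ≡ suc k

IsDistFrom : ∀ {n} → ParentMap n → Fin n → (Fin n → ℕ) → Set
IsDistFrom T x f = ∀ u → TreeDist T x u (f u)

SdIs : ∀ {n} → ParentMap n → Fin n → ℕ → Set
SdIs T r s = Σ (Fin _ → ℕ) λ f → IsDistFrom T r f × sum (tabulate f) ≡ s

DevIs : ∀ {k} → ParentMap (suc k) → Fin (suc k) → ℚᵘ → Set
DevIs {k} T v q = Σ (Fin (suc k) → ℕ) λ f → IsDistFrom T v f × q ≡ (+ sum (tabulate f)) / suc k

IsCentroid : ∀ {k} → ParentMap (suc k) → Fin (suc k) → Set
IsCentroid T v = Σ ℚᵘ λ mv → DevIs T v mv × (∀ u mu → DevIs T u mu → mv ≤ℚ mu)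

-- Breadth-first search, with all its nondeterministic choices (the order in
-- which the undiscovered neighbours of the dequeued vertex are enqueued).
-- BFSRun G queue discovered parent final : running BFS from this state can end
-- with parent map 'final'.
data BFSRun {n : ℕ} (G : Graph n) : List (Fin n) → List (Fin n) → ParentMap n → ParentMap n → Set where
  done : ∀ {D par} → BFSRun G [] D par par
  step : ∀ {u q D par par' final} (new : List (Fin n)) →
         Unique new →
         (∀ w → (w ∈ new) ⇔ (Adj G u w × w ∉ D)) →
         (∀ w → w ∈ new → par' w ≡ just u) →
         (∀ w → w ∉ new → par' w ≡ par w) →
         BFSRun G (q ++ new) (D ++ new) par' final →
         BFSRun G (u ∷ q) D par final

IsBFSTree : ∀ {n} → Graph n → Fin n → ParentMap n → Set
IsBFSTree G v T = BFSRun G (v ∷ []) (v ∷ []) (λ _ → nothing) T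

-- Breadth-first search from v labels every vertex x with a level that is both the number
-- of edges of the tree path from v to x and a lower bound on the number of edges of every
-- walk from v to x in G: the BFS tree rooted at v realises the graph distances from v.
-- As T_m is a subgraph of G, for every vertex u
--   Σ_x d_{T_m}(u,x) ≥ Σ_x d_G(u,x) = S_d(P u) ≥ S_d(T_m) = Σ_x d_{T_m}(r,x),
-- which is the centroid property of r after dividing by |V'|.
module Submission where

open import Defs
open import Data.Nat using (ℕ; zero; suc; _≤_; _<_; _+_; z≤n; s≤s)
open import Data.Nat.Properties
  using (≤-refl; ≤-reflexive; ≤-pred; m≤n⇒m≤1+n; n≤1+n; +-mono-≤; +-comm; +-suc;
         suc-injective; 0≢1+n; 1+n≰n; module ≤-Reasoning)
open import Data.Fin using (Fin; zero; suc)
open import Data.Fin.Properties using (_≟_)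
open import Data.List using (List; []; _∷_; _++_; _∷ʳ_; length; tabulate)
open import Data.List.Properties using (length-++)
open import Data.Nat.ListAction using (sum)
open import Data.List.Membership.Propositional using (_∈_; _∉_)
open import Data.List.Membership.Propositional.Properties using (∈-++⁺ˡ; ∈-++⁺ʳ; ∈-++⁻)
open import Data.List.Relation.Binary.Subset.Propositional using (_⊆_)
open import Data.List.Relation.Unary.Any using (here; there)
open import Data.List.Relation.Unary.All as All using (All; []; _∷_)
import Data.List.Relation.Unary.All.Properties as All
open import Data.List.Relation.Unary.AllPairs as AllPairs using (AllPairs; []; _∷_)
import Data.List.Relation.Unary.AllPairs.Properties as AllPairs
open import Data.List.Relation.Unary.Unique.Propositional using (Unique)
import Data.List.Relation.Unary.Unique.Propositional.Properties as Unique
open import Data.Maybe using (just; nothing)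
open import Data.Maybe.Properties using (just-injective)
open import Data.Product using (Σ; _×_; _,_; proj₁; proj₂; ∃₂)
open import Data.Sum using (_⊎_; inj₁; inj₂)
open import Data.Empty using (⊥-elim)
open import Data.Integer using (+_; +≤+)
import Data.Integer.Properties as ℤ
open import Data.Rational.Unnormalised using (_/_; *≤*) renaming (_≤_ to _≤ℚ_)
open import Relation.Binary.PropositionalEquality as ≡ using (_≡_; refl; trans; cong; subst; subst₂)
open import Relation.Nullary using (yes; no)
open import Function using (_∘_; _on_)
open import Function.Bundles using (_⇔_; Equivalence)

Walk-map : ∀ {n} {E E′ : Fin n → Fin n → Set} → (∀ {a b} → E a b → E′ a b) →
           ∀ {x y vs} → Walk E x y vs → Walk E′ x y vs
Walk-map f here        = here
Walk-map f (there e w) = there (f e) (Walk-map f w)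

Walk-∷ʳ : ∀ {n} {E : Fin n → Fin n → Set} {x y z vs} → Walk E x y vs → E y z → Walk E x z (vs ∷ʳ z)
Walk-∷ʳ here         e = there e here
Walk-∷ʳ (there e′ w) e = there e′ (Walk-∷ʳ w e)

Unique-∷ʳ : ∀ {A : Set} {xs : List A} {x} → Unique xs → x ∉ xs → Unique (xs ∷ʳ x)
Unique-∷ʳ uniq x∉xs = Unique.++⁺ uniq ([] ∷ []) λ { (x∈xs , here refl) → x∉xs x∈xs }

AllPairs-on-cong : ∀ {A B : Set} {R : B → B → Set} {f g : A → B} {xs} →
                   (∀ {a} → a ∈ xs → f a ≡ g a) → AllPairs (R on f) xs → AllPairs (R on g) xs
AllPairs-on-cong {R = R} f≡g [] = []
AllPairs-on-cong {R = R} f≡g (r ∷ rs) =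
  All.tabulate (λ b∈ → subst₂ R (f≡g (here refl)) (f≡g (there b∈)) (All.lookup r b∈))
  ∷ AllPairs-on-cong {R = R} (f≡g ∘ there) rs

AllPairs-≤-constant : ∀ {A : Set} {f : A → ℕ} {c xs} →
                      (∀ {a} → a ∈ xs → f a ≡ c) → AllPairs (_≤_ on f) xs
AllPairs-≤-constant {xs = []}    f≡c = []
AllPairs-≤-constant {xs = _ ∷ _} f≡c =
  All.tabulate (λ b∈ → ≤-reflexive (trans (f≡c (here refl)) (≡.sym (f≡c (there b∈)))))
  ∷ AllPairs-≤-constant (f≡c ∘ there)

sum-tabulate-mono : ∀ {m} {f g : Fin m → ℕ} → (∀ i → f i ≤ g i) → sum (tabulate f) ≤ sum (tabulate g)
sum-tabulate-mono {zero}  f≤g = z≤n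
sum-tabulate-mono {suc m} f≤g = +-mono-≤ (f≤g zero) (sum-tabulate-mono (f≤g ∘ suc))

/-monoˡ-≤ : ∀ {a b} k → a ≤ b → (+ a) / suc k ≤ℚ (+ b) / suc k
/-monoˡ-≤ k a≤b = *≤* (ℤ.*-monoʳ-≤-nonNeg (+ suc k) (+≤+ a≤b))

-- vs lists the vertices of the walk, so length vs is one more than its number of edges.
BoundsWalksFrom : ∀ {n} → (Fin n → Fin n → Set) → Fin n → (Fin n → ℕ) → Set
BoundsWalksFrom E u d = ∀ {x vs} → Walk E u x vs → d x < length vs

bound-≤-subtreeDistance : ∀ {n} {G : Graph n} {T : ParentMap n} {u d f} →
  (∀ {x y} → TEdge T x y → Adj G x y) → BoundsWalksFrom (Adj G) u d → IsDistFrom T u f →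
  ∀ x → d x ≤ f x
bound-≤-subtreeDistance T⊆G bound f-dist x with f-dist x
... | _ , walk , _ , len = ≤-pred (subst (_ <_) len (bound (Walk-map T⊆G walk)))

module BFS {n : ℕ} (G : Graph n) (v : Fin n) where
  open import Data.List.Membership.DecPropositional (_≟_ {n}) using (_∈?_)

  -- lvl is a ghost labelling: the BFS layer in which each discovered vertex was found.
  record Invariant (q D : List (Fin n)) (par : ParentMap n) (lvl : Fin n → ℕ) : Set where
    field
      root∈D       : v ∈ D
      root-level   : lvl v ≡ 0
      root-parent  : par v ≡ nothing
      parent       : ∀ {x} → x ∈ D → x ≡ v ⊎
                     Σ (Fin n) λ y → par x ≡ just y × y ∈ D × lvl x ≡ suc (lvl y) × Adj G y x
      queue⊆D      : q ⊆ D
      closed       : ∀ {a} → a ∈ D → a ∈ q ⊎ (∀ {b} → Adj G a b → b ∈ D × lvl b ≤ suc (lvl a))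
      queue-bound  : ∀ {a b} → b ∈ D → a ∈ q → lvl b ≤ suc (lvl a)
      queue-sorted : AllPairs (_≤_ on lvl) q

  setLevel : List (Fin n) → ℕ → (Fin n → ℕ) → Fin n → ℕ
  setLevel new c lvl w with w ∈? new
  ... | yes _ = c
  ... | no  _ = lvl w

  setLevel-∈ : ∀ {new c lvl w} → w ∈ new → setLevel new c lvl w ≡ c
  setLevel-∈ {new} {w = w} w∈new with w ∈? new
  ... | yes _     = refl
  ... | no  w∉new = ⊥-elim (w∉new w∈new)

  setLevel-∉ : ∀ {new c lvl w} → w ∉ new → setLevel new c lvl w ≡ lvl w
  setLevel-∉ {new} {w = w} w∉new with w ∈? new
  ... | yes w∈new = ⊥-elim (w∉new w∈new)
  ... | no  _     = refl

  module Step {u : Fin n} {q D : List (Fin n)} {par par′ : ParentMap n} {lvl : Fin n → ℕ} (new : List (Fin n))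
              (new⇔ : ∀ w → (w ∈ new) ⇔ (Adj G u w × w ∉ D))
              (par′-new : ∀ w → w ∈ new → par′ w ≡ just u)
              (par′-old : ∀ w → w ∉ new → par′ w ≡ par w)
              (I : Invariant (u ∷ q) D par lvl) where
    open Invariant I

    lvl′ : Fin n → ℕ
    lvl′ = setLevel new (suc (lvl u)) lvl

    new⇒adj : ∀ {w} → w ∈ new → Adj G u w
    new⇒adj {w} w∈new = proj₁ (Equivalence.to (new⇔ w) w∈new)

    D⇒∉new : ∀ {w} → w ∈ D → w ∉ new
    D⇒∉new {w} w∈D w∈new = proj₂ (Equivalence.to (new⇔ w) w∈new) w∈D

    adj⇒new : ∀ {w} → Adj G u w → w ∉ D → w ∈ new
    adj⇒new {w} adj w∉D = Equivalence.from (new⇔ w) (adj , w∉D)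

    lvl′-D : ∀ {w} → w ∈ D → lvl′ w ≡ lvl w
    lvl′-D = setLevel-∉ ∘ D⇒∉new

    lvl′-new : ∀ {w} → w ∈ new → lvl′ w ≡ suc (lvl u)
    lvl′-new = setLevel-∈

    u∈D : u ∈ D
    u∈D = queue⊆D (here refl)

    lvl′-u : lvl′ u ≡ lvl u
    lvl′-u = lvl′-D u∈D

    lvl′-q : ∀ {a} → a ∈ q → lvl′ a ≡ lvl a
    lvl′-q = lvl′-D ∘ queue⊆D ∘ there

    lvl′-≤-suc : ∀ {a b i j} → lvl′ b ≡ i → lvl′ a ≡ j → i ≤ suc j → lvl′ b ≤ suc (lvl′ a)
    lvl′-≤-suc refl refl i≤1+j = i≤1+j

    head-least : ∀ {a} → a ∈ q → lvl u ≤ lvl a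
    head-least = All.lookup (AllPairs.head queue-sorted)

    parent′ : ∀ {x} → x ∈ D ++ new → x ≡ v ⊎
              Σ (Fin n) λ y → par′ x ≡ just y × y ∈ D ++ new × lvl′ x ≡ suc (lvl′ y) × Adj G y x
    parent′ {x} x∈ with ∈-++⁻ D x∈
    ... | inj₂ x∈new =
      inj₂ (u , par′-new x x∈new , ∈-++⁺ˡ u∈D ,
            trans (lvl′-new x∈new) (cong suc (≡.sym lvl′-u)) , new⇒adj x∈new)
    ... | inj₁ x∈D with parent x∈D
    ...   | inj₁ x≡v = inj₁ x≡v
    ...   | inj₂ (y , px , y∈D , lx , adj) =
      inj₂ (y , trans (par′-old x (D⇒∉new x∈D)) px , ∈-++⁺ˡ y∈D ,
            trans (lvl′-D x∈D) (trans lx (cong suc (≡.sym (lvl′-D y∈D)))) , adj)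

    queue⊆D′ : q ++ new ⊆ D ++ new
    queue⊆D′ a∈ with ∈-++⁻ q a∈
    ... | inj₁ a∈q   = ∈-++⁺ˡ (queue⊆D (there a∈q))
    ... | inj₂ a∈new = ∈-++⁺ʳ D a∈new

    head-closed : ∀ {b} → Adj G u b → b ∈ D ++ new × lvl′ b ≤ suc (lvl′ u)
    head-closed {b} adj with b ∈? D
    ... | yes b∈D = ∈-++⁺ˡ b∈D , lvl′-≤-suc (lvl′-D b∈D) lvl′-u (queue-bound b∈D (here refl))
    ... | no  b∉D = ∈-++⁺ʳ D b∈new , lvl′-≤-suc (lvl′-new b∈new) lvl′-u ≤-refl
      where b∈new = adj⇒new adj b∉D

    closed′ : ∀ {a} → a ∈ D ++ new →
              a ∈ q ++ new ⊎ (∀ {b} → Adj G a b → b ∈ D ++ new × lvl′ b ≤ suc (lvl′ a))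
    closed′ a∈ with ∈-++⁻ D a∈
    ... | inj₂ a∈new = inj₁ (∈-++⁺ʳ q a∈new)
    ... | inj₁ a∈D with closed a∈D
    ...   | inj₁ (here refl) = inj₂ head-closed
    ...   | inj₁ (there a∈q) = inj₁ (∈-++⁺ˡ a∈q)
    ...   | inj₂ edges = inj₂ λ adj → let (b∈D , lb) = edges adj in
              ∈-++⁺ˡ b∈D , lvl′-≤-suc (lvl′-D b∈D) (lvl′-D a∈D) lb

    queue-bound′ : ∀ {a b} → b ∈ D ++ new → a ∈ q ++ new → lvl′ b ≤ suc (lvl′ a)
    queue-bound′ b∈ a∈ with ∈-++⁻ D b∈ | ∈-++⁻ q a∈
    ... | inj₁ b∈D   | inj₁ a∈q   = lvl′-≤-suc (lvl′-D b∈D) (lvl′-q a∈q) (queue-bound b∈D (there a∈q))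
    ... | inj₁ b∈D   | inj₂ a∈new =
      lvl′-≤-suc (lvl′-D b∈D) (lvl′-new a∈new) (m≤n⇒m≤1+n (queue-bound b∈D (here refl)))
    ... | inj₂ b∈new | inj₁ a∈q   = lvl′-≤-suc (lvl′-new b∈new) (lvl′-q a∈q) (s≤s (head-least a∈q))
    ... | inj₂ b∈new | inj₂ a∈new = lvl′-≤-suc (lvl′-new b∈new) (lvl′-new a∈new) (n≤1+n _)

    queue-sorted′ : AllPairs (_≤_ on lvl′) (q ++ new)
    queue-sorted′ = AllPairs.++⁺
      (AllPairs-on-cong {R = _≤_} (≡.sym ∘ lvl′-q) (AllPairs.tail queue-sorted))
      (AllPairs-≤-constant lvl′-new)
      (All.tabulate λ a∈q → All.tabulate λ b∈new →
        subst₂ _≤_ (≡.sym (lvl′-q a∈q)) (≡.sym (lvl′-new b∈new))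
          (queue-bound (queue⊆D (there a∈q)) (here refl)))

    invariant : Invariant (q ++ new) (D ++ new) par′ lvl′
    invariant = record
      { root∈D       = ∈-++⁺ˡ root∈D
      ; root-level   = trans (lvl′-D root∈D) root-level
      ; root-parent  = trans (par′-old v (D⇒∉new root∈D)) root-parent
      ; parent       = parent′
      ; queue⊆D      = queue⊆D′
      ; closed       = closed′
      ; queue-bound  = queue-bound′
      ; queue-sorted = queue-sorted′
      }

  initial : Invariant (v ∷ []) (v ∷ []) (λ _ → nothing) (λ _ → 0)
  initial = record
    { root∈D       = here refl
    ; root-level   = refl
    ; root-parent  = refl
    ; parent       = λ { (here x≡v) → inj₁ x≡v }
    ; queue⊆D      = λ a∈q → a∈q
    ; closed       = inj₁
    ; queue-bound  = λ _ _ → z≤n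
    ; queue-sorted = [] ∷ []
    }

  finish : ∀ {q D par T lvl} → BFSRun G q D par T → Invariant q D par lvl →
           ∃₂ λ D′ lvl′ → Invariant [] D′ T lvl′
  finish done I = _ , _ , I
  finish (step new _ new⇔ par′-new par′-old run) I =
    finish run (Step.invariant new new⇔ par′-new par′-old I)

  module Completed {D : List (Fin n)} {T : ParentMap n} {lvl : Fin n → ℕ} (I : Invariant [] D T lvl) where
    open Invariant I

    edge-closed : ∀ {a b} → a ∈ D → Adj G a b → b ∈ D × lvl b ≤ suc (lvl a)
    edge-closed a∈D adj with closed a∈D
    ... | inj₁ ()
    ... | inj₂ edges = edges adj

    walk-lower-bound : ∀ {a x vs} → a ∈ D → Walk (Adj G) a x vs → x ∈ D × lvl x < lvl a + length vs
    walk-lower-bound {a} a∈D here = a∈D , ≤-reflexive (+-comm 1 (lvl a))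
    walk-lower-bound {a} {x} a∈D (there {z = z} {vs = vs} adj walk) with edge-closed a∈D adj
    ... | z∈D , lz with walk-lower-bound z∈D walk
    ...   | x∈D , lx = x∈D , (begin-strict
      lvl x                  <⟨ lx ⟩
      lvl z + length vs      ≤⟨ +-mono-≤ lz ≤-refl ⟩
      suc (lvl a) + length vs ≡⟨ ≡.sym (+-suc (lvl a) (length vs)) ⟩
      lvl a + suc (length vs) ∎)
      where open ≤-Reasoning

    all-discovered : Connected G → ∀ x → x ∈ D
    all-discovered connected x = proj₁ (walk-lower-bound root∈D (proj₂ (connected v x)))

    level-bounds-walks : BoundsWalksFrom (Adj G) v lvl
    level-bounds-walks {x} {vs} walk =
      subst (λ l → lvl x < l + length vs) root-level (proj₂ (walk-lower-bound root∈D walk))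

    tree-path : ∀ m {x} → x ∈ D → lvl x ≡ m → Σ (List (Fin n)) λ vs →
                Walk (TEdge T) v x vs × Unique vs × length vs ≡ suc m × All (λ w → lvl w ≤ m) vs
    tree-path m x∈D lx with parent x∈D
    tree-path zero    x∈D lx | inj₁ refl = v ∷ [] , here , [] ∷ [] , refl , ≤-reflexive lx ∷ []
    tree-path (suc m) x∈D lx | inj₁ refl = ⊥-elim (0≢1+n (trans (≡.sym root-level) lx))
    tree-path zero    x∈D lx | inj₂ (_ , _ , _ , ly , _) = ⊥-elim (0≢1+n (trans (≡.sym lx) ly))
    tree-path (suc m) {x} x∈D lx | inj₂ (y , px , y∈D , ly , _)
      with tree-path m y∈D (suc-injective (trans (≡.sym ly) lx))
    ... | vs , walk , uniq , len , below =
      vs ∷ʳ x , Walk-∷ʳ walk (inj₂ px) , Unique-∷ʳ uniq x∉vs ,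
      trans (length-++ vs) (trans (+-comm (length vs) 1) (cong suc len)) ,
      All.++⁺ (All.map m≤n⇒m≤1+n below) (≤-reflexive lx ∷ [])
      where
      x∉vs : x ∉ vs
      x∉vs x∈vs = 1+n≰n (subst (_≤ m) lx (All.lookup below x∈vs))

    level-is-tree-distance : Connected G → IsDistFrom T v lvl
    level-is-tree-distance connected x with tree-path (lvl x) (all-discovered connected x) refl
    ... | vs , walk , uniq , len , _ = vs , walk , uniq , len

    parent-adj : ∀ {x y} → x ∈ D → T x ≡ just y → Adj G y x
    parent-adj x∈D px with parent x∈D
    ... | inj₁ refl with trans (≡.sym root-parent) px
    ...   | ()
    parent-adj x∈D px | inj₂ (_ , px′ , _ , _ , adj) with just-injective (trans (≡.sym px′) px)
    ...   | refl = adj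

    tree-edge⇒adj : Connected G → ∀ {x y} → TEdge T x y → Adj G x y
    tree-edge⇒adj connected (inj₁ px) = Graph.sym G (parent-adj (all-discovered connected _) px)
    tree-edge⇒adj connected (inj₂ py) = parent-adj (all-discovered connected _) py

module BFSTree {n} {G : Graph n} (connected : Connected G) {v : Fin n} {T : ParentMap n}
               (bfs : IsBFSTree G v T) where
  open BFS G v

  private
    completed : ∃₂ λ D lvl → Invariant [] D T lvl
    completed = finish bfs initial

    module C = Completed (proj₂ (proj₂ completed))

  level : Fin n → ℕ
  level = proj₁ (proj₂ completed)

  level-is-tree-distance : IsDistFrom T v level
  level-is-tree-distance = C.level-is-tree-distance connected

  level-bounds-walks : BoundsWalksFrom (Adj G) v level
  level-bounds-walks = C.level-bounds-walks

  edge⇒adj : ∀ {x y} → TEdge T x y → Adj G x y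
  edge⇒adj = C.tree-edge⇒adj connected

lemma5p14 : (k : ℕ) (G : Graph (suc k)) → Connected G →
    (P : Fin (suc k) → ParentMap (suc k)) → (∀ v → IsBFSTree G v (P v)) →
    (r : Fin (suc k)) →
    (∀ v s s' → SdIs (P r) r s → SdIs (P v) v s' → s ≤ s') →
    IsCentroid (P r) r
lemma5p14 k G connected P bfs r minimal =
  _ , (BT.level r , BT.level-is-tree-distance r , refl) , r-minimises
  where
  module BT (v : Fin (suc k)) = BFSTree connected (bfs v)

  S : Fin (suc k) → ℕ
  S v = sum (tabulate (BT.level v))

  r-minimises : ∀ u mu → DevIs (P r) u mu → (+ S r) / suc k ≤ℚ mu
  r-minimises u _ (f , f-dist , refl) = /-monoˡ-≤ k (begin
    S r              ≤⟨ minimal u _ _ (_ , BT.level-is-tree-distance r , refl)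
                                      (_ , BT.level-is-tree-distance u , refl) ⟩
    S u              ≤⟨ sum-tabulate-mono
                          (bound-≤-subtreeDistance {G = G} (BT.edge⇒adj r) (BT.level-bounds-walks u) f-dist) ⟩
    sum (tabulate f) ∎)
    where open ≤-Reasoning
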